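{- Let $V$ be a finite set. If $g_1$ and $g_2$ are switching equivalent $3$-tournaments on $V$, then $\mathcal{H}(g_1)=\mathcal{H}(g_2)$.
   Context: A $3$-tournament on $V$ is an alternating function $g$ (interchanging two arguments changes the sign) from ordered triples of distinct elements of $V$ to $\{\pm1\}$. A two-graph on $V$ is a set $\mathcal{X}$ of $3$-subsets of $V$ such that every $4$-subset of $V$ contains zero, two or four members of $\mathcal{X}$. For a $3$-tournament $g$ and two-graph $\mathcal{X}$, $g^{\mathcal{X}}(x,y,z)=g(x,y,z)$ if $\{x,y,z\}\in\mathcal{X}$ and $-g(x,y,z)$ otherwise. $g_1,g_2$ are switching equivalent if $g_2=g_1^{\mathcal{X}}$ for some two-graph $\mathcal{X}$. For a $3$-tournament $g$, $\mathcal{H}(g)$ is the set of $4$-subsets $\{x,y,z,w\}$ of $V$ with $g(x,y,z)g(y,x,w)g(z,y,w)g(x,z,w)=+1$ (this condition is independent of the ordering). -}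

module Defs where

open import Data.Nat using (ℕ)
open import Data.Fin using (Fin)
open import Data.Bool using (Bool; true; false; if_then_else_)
open import Data.Sign using (Sign; opposite; _*_) renaming (+ to ⊕)
open import Data.Product using (Σ; _×_; _,_)
open import Data.Sum using (_⊎_)
open import Data.Nat using (_+_)
open import Relation.Binary.PropositionalEquality using (_≡_; _≢_)
open import Function.Bundles using (_⇔_)

-- The finite set V is modelled as Fin n.  {±1} is Data.Sign.Sign.

Distinct3 : {n : ℕ} → Fin n → Fin n → Fin n → Set
Distinct3 x y z = x ≢ y × x ≢ z × y ≢ z

Distinct4 : {n : ℕ} → Fin n → Fin n → Fin n → Fin n → Set
Distinct4 x y z w = x ≢ y × x ≢ z × x ≢ w × y ≢ z × y ≢ w × z ≢ w

-- A function on ordered triples; only values on triples of distinct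
-- elements matter.  Alternating: swapping two arguments flips the sign
-- (the transpositions (12) and (23) generate all of S₃).
IsAlternating : {n : ℕ} → (Fin n → Fin n → Fin n → Sign) → Set
IsAlternating {n} g = (x y z : Fin n) → Distinct3 x y z →
  (g y x z ≡ opposite (g x y z)) × (g x z y ≡ opposite (g x y z))

ThreeTournament : ℕ → Set
ThreeTournament n = Σ (Fin n → Fin n → Fin n → Sign) IsAlternating

-- A set of 3-subsets of V, represented by its (decidable) membership
-- predicate on ordered triples of distinct elements, required to be
-- invariant under permuting the triple.
IsSymmetric3 : {n : ℕ} → (Fin n → Fin n → Fin n → Bool) → Set
IsSymmetric3 {n} X = (x y z : Fin n) → Distinct3 x y z →
  (X y x z ≡ X x y z) × (X x z y ≡ X x y z)

count4 : Bool → Bool → Bool → Bool → ℕ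
count4 a b c d = b2n a + (b2n b + (b2n c + b2n d))
  where
  b2n : Bool → ℕ
  b2n true = 1
  b2n false = 0

IsTwoGraph : {n : ℕ} → (Fin n → Fin n → Fin n → Bool) → Set
IsTwoGraph {n} X = IsSymmetric3 X × ((x y z w : Fin n) → Distinct4 x y z w →
  let c = count4 (X x y z) (X x y w) (X x z w) (X y z w)
  in (c ≡ 0) ⊎ ((c ≡ 2) ⊎ (c ≡ 4)))

TwoGraph : ℕ → Set
TwoGraph n = Σ (Fin n → Fin n → Fin n → Bool) IsTwoGraph

switch : {n : ℕ} → (Fin n → Fin n → Fin n → Sign) → (Fin n → Fin n → Fin n → Bool) →
         Fin n → Fin n → Fin n → Sign
switch g X x y z = if X x y z then g x y z else opposite (g x y z)

SwitchingEquivalent : {n : ℕ} → ThreeTournament n → ThreeTournament n → Set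
SwitchingEquivalent {n} (g₁ , _) (g₂ , _) = Σ (TwoGraph n) λ { (X , _) →
  (x y z : Fin n) → Distinct3 x y z → g₂ x y z ≡ switch g₁ X x y z }

InH : {n : ℕ} → ThreeTournament n → Fin n → Fin n → Fin n → Fin n → Set
InH (g , _) x y z w = g x y z * g y x w * g z y w * g x z w ≡ ⊕

module Submission where

open import Defs
open import Data.Nat using (ℕ; zero; suc)
open import Data.Fin using (Fin)
open import Function.Bundles using (_⇔_; mk⇔)
open import Data.Bool using (Bool; true; false; if_then_else_)
open import Data.Sign using (Sign; opposite; _*_) renaming (+ to ⊕; - to ⊖)
open import Data.Sign.Properties using (*-commutativeSemigroup)
open import Algebra.Properties.CommutativeSemigroup *-commutativeSemigroup
  using (interchange; xy∙z≈xz∙y)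
open import Data.Product using (_,_; proj₁)
open import Data.Sum using (_⊎_; [_,_]′)
open import Relation.Binary.PropositionalEquality
  using (_≡_; refl; sym; trans; cong; cong₂; ≢-sym; module ≡-Reasoning)

-- Switching multiplies each value by sign (X x y z).  The four factors of the
-- product defining 𝓗 are indexed by the four 3-subsets of {x,y,z,w}, and a
-- two-graph contains an even number of them, so the product is unchanged.

sign : Bool → Sign
sign true  = ⊕
sign false = ⊖

if-opposite≡sign* : ∀ b s → (if b then s else opposite s) ≡ sign b * s
if-opposite≡sign* true  s = refl
if-opposite≡sign* false s = refl

−1^_ : ℕ → Sign
−1^ zero  = ⊕
−1^ suc k = opposite (−1^ k)

-- With four flags, (−1)^(number of falses) = (−1)^(number of trues).
sign-product≡−1^count4 : ∀ a b c d →
  sign a * sign b * sign c * sign d ≡ −1^ count4 a b c d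
sign-product≡−1^count4 true  true  true  true  = refl
sign-product≡−1^count4 true  true  true  false = refl
sign-product≡−1^count4 true  true  false true  = refl
sign-product≡−1^count4 true  true  false false = refl
sign-product≡−1^count4 true  false true  true  = refl
sign-product≡−1^count4 true  false true  false = refl
sign-product≡−1^count4 true  false false true  = refl
sign-product≡−1^count4 true  false false false = refl
sign-product≡−1^count4 false true  true  true  = refl
sign-product≡−1^count4 false true  true  false = refl
sign-product≡−1^count4 false true  false true  = refl
sign-product≡−1^count4 false true  false false = refl
sign-product≡−1^count4 false false true  true  = refl
sign-product≡−1^count4 false false true  false = refl
sign-product≡−1^count4 false false false true  = refl
sign-product≡−1^count4 false false false false = refl

sign-product-even : ∀ a b c d → let k = count4 a b c d in
  (k ≡ 0) ⊎ ((k ≡ 2) ⊎ (k ≡ 4)) → sign a * sign b * sign c * sign d ≡ ⊕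
sign-product-even a b c d k∈024 =
  trans (sign-product≡−1^count4 a b c d)
        ([ cong −1^_ , [ cong −1^_ , cong −1^_ ]′ ]′ k∈024)

two-graph-sign-product : ∀ {n} {X : Fin n → Fin n → Fin n → Bool} → IsTwoGraph X →
  ∀ x y z w → Distinct4 x y z w →
  sign (X x y z) * sign (X x y w) * sign (X x z w) * sign (X y z w) ≡ ⊕
two-graph-sign-product {X = X} (_ , even) x y z w d =
  sign-product-even (X x y z) (X x y w) (X x z w) (X y z w) (even x y z w d)

*-interchange₄ : ∀ a₁ a₂ a₃ a₄ s₁ s₂ s₃ s₄ →
  (a₁ * s₁) * (a₂ * s₂) * (a₃ * s₃) * (a₄ * s₄) ≡
  (a₁ * a₂ * a₃ * a₄) * (s₁ * s₂ * s₃ * s₄)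
*-interchange₄ a₁ a₂ a₃ a₄ s₁ s₂ s₃ s₄ = begin
  (a₁ * s₁) * (a₂ * s₂) * (a₃ * s₃) * (a₄ * s₄)
    ≡⟨ cong (λ t → t * (a₃ * s₃) * (a₄ * s₄)) (interchange a₁ s₁ a₂ s₂) ⟩
  (a₁ * a₂) * (s₁ * s₂) * (a₃ * s₃) * (a₄ * s₄)
    ≡⟨ cong (_* (a₄ * s₄)) (interchange (a₁ * a₂) (s₁ * s₂) a₃ s₃) ⟩
  (a₁ * a₂ * a₃) * (s₁ * s₂ * s₃) * (a₄ * s₄)
    ≡⟨ interchange (a₁ * a₂ * a₃) (s₁ * s₂ * s₃) a₄ s₄ ⟩
  (a₁ * a₂ * a₃ * a₄) * (s₁ * s₂ * s₃ * s₄)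
    ∎
  where open ≡-Reasoning

switching-preserves-H-product : ∀ {n} (g₁ g₂ : ThreeTournament n) →
  SwitchingEquivalent g₁ g₂ → ∀ x y z w → Distinct4 x y z w →
  let g = proj₁ g₁ ; h = proj₁ g₂ in
  h x y z * h y x w * h z y w * h x z w ≡ g x y z * g y x w * g z y w * g x z w
switching-preserves-H-product (g , _) (h , _) ((X , X-sym , X-even) , h≡gˣ) x y z w
                              d@(x≢y , x≢z , x≢w , y≢z , y≢w , z≢w) = begin
  h x y z * h y x w * h z y w * h x z w
    ≡⟨ cong₂ _*_ (cong₂ _*_ (cong₂ _*_ (switched x y z (x≢y , x≢z , y≢z))
                                       (switched y x w (≢-sym x≢y , y≢w , x≢w)))
                            (switched z y w (≢-sym y≢z , z≢w , y≢w)))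
                 (switched x z w (x≢z , x≢w , z≢w)) ⟩
  sign (X x y z) * g x y z * (sign (X y x w) * g y x w)
    * (sign (X z y w) * g z y w) * (sign (X x z w) * g x z w)
    ≡⟨ *-interchange₄ (sign (X x y z)) _ _ (sign (X x z w)) _ _ _ _ ⟩
  sign (X x y z) * sign (X y x w) * sign (X z y w) * sign (X x z w) * G
    ≡⟨ cong (λ t → t * G)
         (cong₂ (λ p q → sign (X x y z) * sign p * sign q * sign (X x z w))
                (proj₁ (X-sym x y w (x≢y , x≢w , y≢w)))
                (proj₁ (X-sym y z w (y≢z , y≢w , z≢w)))) ⟩
  sign (X x y z) * sign (X x y w) * sign (X y z w) * sign (X x z w) * G
    ≡⟨ cong (_* G) (xy∙z≈xz∙y (sign (X x y z) * sign (X x y w)) _ _) ⟩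
  sign (X x y z) * sign (X x y w) * sign (X x z w) * sign (X y z w) * G
    ≡⟨ cong (_* G) (two-graph-sign-product (X-sym , X-even) x y z w d) ⟩
  G
    ∎
  where
  open ≡-Reasoning
  G : Sign
  G = g x y z * g y x w * g z y w * g x z w
  switched : ∀ u v t → Distinct3 u v t → h u v t ≡ sign (X u v t) * g u v t
  switched u v t uvt = trans (h≡gˣ u v t uvt) (if-opposite≡sign* (X u v t) (g u v t))

lemma6p3 : (n : ℕ) (g₁ g₂ : ThreeTournament n) → SwitchingEquivalent g₁ g₂ →
    (x y z w : Fin n) → Distinct4 x y z w → (InH g₁ x y z w ⇔ InH g₂ x y z w)
lemma6p3 n g₁ g₂ g₁~g₂ x y z w d = mk⇔ (trans H-product) (trans (sym H-product))
  where
  H-product : proj₁ g₂ x y z * proj₁ g₂ y x w * proj₁ g₂ z y w * proj₁ g₂ x z w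
            ≡ proj₁ g₁ x y z * proj₁ g₁ y x w * proj₁ g₁ z y w * proj₁ g₁ x z w
  H-product = switching-preserves-H-product g₁ g₂ g₁~g₂ x y z w d
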